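{- Let $n\ge 2$, let $\mu$ be a prime, and let $P(X)=X^n+\sum_{1\le i\le n/2}\varepsilon_iX^i\pm\mu$ with all $\varepsilon_i\in\{ -1,0,1\}$. If $\mu>1+\sum_{1\le i\le n/2}|\varepsilon_i|$, then $P(X)$ is irreducible over $\mathbb{Z}[X]$. -}

module Defs where

open import Data.Nat as ℕ using (ℕ; zero; suc; _∸_; _/_)
open import Data.Integer as ℤ using (ℤ; +_; -[1+_]; -_)
open import Data.List as List using (List; []; _∷_; _++_; map; replicate; tabulate; [_])
open import Data.Fin using (Fin)
open import Data.Nat.ListAction using (sum)
open import Data.Product using (_×_)
open import Data.Sum using (_⊎_)
open import Relation.Nullary using (¬_)
open import Relation.Binary.PropositionalEquality using (_≡_)

-- Integer polynomials as coefficient lists, lowest degree first.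
-- Trailing zeros are allowed; equality of polynomials is coefficientwise.
Poly : Set
Poly = List ℤ

coeff : Poly → ℕ → ℤ
coeff []      _       = + 0
coeff (a ∷ p) zero    = a
coeff (a ∷ p) (suc k) = coeff p k

infixl 6 _+ₚ_
infixl 7 _*ₚ_
infix  4 _≈ₚ_

_+ₚ_ : Poly → Poly → Poly
[]      +ₚ q       = q
(a ∷ p) +ₚ []      = a ∷ p
(a ∷ p) +ₚ (b ∷ q) = (a ℤ.+ b) ∷ (p +ₚ q)

_*ₚ_ : Poly → Poly → Poly
[]      *ₚ q = []
(a ∷ p) *ₚ q = map (a ℤ.*_) q +ₚ (+ 0 ∷ (p *ₚ q))

_≈ₚ_ : Poly → Poly → Set
p ≈ₚ q = ∀ k → coeff p k ≡ coeff q k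

-- Units of ℤ[X] are the constants ±1.
IsUnit : Poly → Set
IsUnit p = (p ≈ₚ [ + 1 ]) ⊎ (p ≈ₚ [ -[1+ 0 ] ])

Irreducible : Poly → Set
Irreducible p =
  ¬ (p ≈ₚ []) × ¬ IsUnit p × (∀ a b → p ≈ₚ a *ₚ b → IsUnit a ⊎ IsUnit b)

IsSign : ℤ → Set
IsSign s = (s ≡ + 1) ⊎ (s ≡ -[1+ 0 ])

IsTrit : ℤ → Set
IsTrit e = (e ≡ -[1+ 0 ]) ⊎ (e ≡ + 0) ⊎ (e ≡ + 1)

-- P(X) = X^n + Σ_{1 ≤ i ≤ n/2} ε_i X^i + s·μ, with ε i (i : Fin ⌊n/2⌋) the
-- coefficient of X^(i+1). Coefficient list has length n+1 when n ≥ 2.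
thePoly : (n : ℕ) → (Fin (n / 2) → ℤ) → ℤ → ℕ → Poly
thePoly n ε s μ =
  (s ℤ.* + μ) ∷ (tabulate ε ++ (replicate (n ∸ 1 ∸ (n / 2)) (+ 0) ++ [ + 1 ]))

absSum : (n : ℕ) → (Fin (n / 2) → ℤ) → ℕ
absSum n ε = sum (tabulate (λ i → ℤ.∣ ε i ∣))

-- Write P = c + X ℓ(X) with |c| = μ prime and Σ|ℓᵢ| < μ. In a factorisation
-- P = a b one factor, say a, has constant term ±1, so it is invertible in ℤ[[X]];
-- let h = a⁻¹. Then b = P h is a polynomial, so for large m the coefficient
-- c h(m+1) + Σ ℓᵢ h(m−i) of P h vanishes, whence μ |h(m+1)| ≤ Σ|ℓᵢ| · max |h|
-- over the preceding window. As Σ|ℓᵢ| < μ, this integer maximum strictly drops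
-- every window length until it reaches 0, so h is a polynomial too; a h = 1 in
-- ℤ[X] then forces a to be a constant ±1.
module Submission where

open import Defs
open import Data.Nat using (ℕ; _≤_; _<_; _+_; _/_)
open import Data.Nat.Primality using (Prime)
open import Data.Integer using (ℤ)
open import Data.Fin using (Fin)

open import Data.Nat using (zero; suc; z≤n; s≤s; _*_; _∸_; _⊔_; _≤?_)
import Data.Nat.Properties as ℕP
open import Data.Nat.Divisibility using (divides)
open import Data.Nat.Primality using (¬prime[0]; ¬prime[1]; prime⇒irreducible; prime⇒nonZero)
open import Data.Nat.ListAction using (sum)
open import Data.Nat.ListAction.Properties using (sum-++)
open import Data.Integer using (+_; -[1+_]; -_; ∣_∣; _≟_)
  renaming (_+_ to _+ᶻ_; _*_ to _*ᶻ_; _-_ to _-ᶻ_)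
import Data.Integer.Properties as ℤP
open import Data.Integer.Tactic.RingSolver using (solve-∀)
open import Data.List using (List; []; _∷_; _++_; map; replicate; tabulate; [_]; length)
open import Data.List.Properties using (map-++; map-tabulate)
open import Data.Product using (∃; _,_; _×_)
open import Data.Sum using (_⊎_; inj₁; inj₂; [_,_]′)
open import Data.Empty using (⊥; ⊥-elim)
open import Relation.Nullary using (¬_; yes; no)
open import Relation.Binary.PropositionalEquality
  using (_≡_; refl; sym; trans; cong; cong₂; subst; subst₂; module ≡-Reasoning)

Series : Set
Series = ℕ → ℤ

shift : Series → Series
shift f i = f (suc i)

infixl 7 _⋆_

_⋆_ : Series → Series → Series
(f ⋆ g) zero    = f 0 *ᶻ g 0
(f ⋆ g) (suc m) = f 0 *ᶻ g (suc m) +ᶻ (shift f ⋆ g) m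

δ : Series
δ zero    = + 1
δ (suc _) = + 0

⋆-congˡ : ∀ {f f′} g → (∀ i → f i ≡ f′ i) → ∀ m → (f ⋆ g) m ≡ (f′ ⋆ g) m
⋆-congˡ g f≡f′ zero    = cong (_*ᶻ g 0) (f≡f′ 0)
⋆-congˡ g f≡f′ (suc m) =
  cong₂ _+ᶻ_ (cong (_*ᶻ g (suc m)) (f≡f′ 0)) (⋆-congˡ g (λ i → f≡f′ (suc i)) m)

⋆-congʳ : ∀ f {g g′} m → (∀ i → i ≤ m → g i ≡ g′ i) → (f ⋆ g) m ≡ (f ⋆ g′) m
⋆-congʳ f zero    g≡g′ = cong (f 0 *ᶻ_) (g≡g′ 0 z≤n)
⋆-congʳ f (suc m) g≡g′ =
  cong₂ _+ᶻ_ (cong (f 0 *ᶻ_) (g≡g′ (suc m) ℕP.≤-refl))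
             (⋆-congʳ (shift f) m (λ i i≤m → g≡g′ i (ℕP.m≤n⇒m≤1+n i≤m)))

⋆-zeroˡ : ∀ {f} g → (∀ i → f i ≡ + 0) → ∀ m → (f ⋆ g) m ≡ + 0
⋆-zeroˡ g f≡0 zero    = cong (_*ᶻ g 0) (f≡0 0)
⋆-zeroˡ g f≡0 (suc m) =
  cong₂ _+ᶻ_ (cong (_*ᶻ g (suc m)) (f≡0 0)) (⋆-zeroˡ g (λ i → f≡0 (suc i)) m)

⋆-distribʳ-+ : ∀ f f′ g m → ((λ i → f i +ᶻ f′ i) ⋆ g) m ≡ (f ⋆ g) m +ᶻ (f′ ⋆ g) m
⋆-distribʳ-+ f f′ g zero    = ℤP.*-distribʳ-+ (g 0) (f 0) (f′ 0)
⋆-distribʳ-+ f f′ g (suc m) =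
  trans (cong ((f 0 +ᶻ f′ 0) *ᶻ g (suc m) +ᶻ_) (⋆-distribʳ-+ (shift f) (shift f′) g m))
        (interchange (f 0) (f′ 0) (g (suc m)) _ _)
  where
  interchange : ∀ a b c x y → (a +ᶻ b) *ᶻ c +ᶻ (x +ᶻ y) ≡ (a *ᶻ c +ᶻ x) +ᶻ (b *ᶻ c +ᶻ y)
  interchange = solve-∀

⋆-scaleˡ : ∀ c f g m → ((λ i → c *ᶻ f i) ⋆ g) m ≡ c *ᶻ (f ⋆ g) m
⋆-scaleˡ c f g zero    = ℤP.*-assoc c (f 0) (g 0)
⋆-scaleˡ c f g (suc m) =
  trans (cong ((c *ᶻ f 0) *ᶻ g (suc m) +ᶻ_) (⋆-scaleˡ c (shift f) g m))
        (factor c (f 0) (g (suc m)) _)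
  where
  factor : ∀ c a b x → (c *ᶻ a) *ᶻ b +ᶻ c *ᶻ x ≡ c *ᶻ (a *ᶻ b +ᶻ x)
  factor = solve-∀

⋆-unfoldʳ : ∀ f g m → (f ⋆ g) (suc m) ≡ (f ⋆ shift g) m +ᶻ f (suc m) *ᶻ g 0
⋆-unfoldʳ f g zero    = refl
⋆-unfoldʳ f g (suc m) =
  trans (cong (f 0 *ᶻ g (suc (suc m)) +ᶻ_) (⋆-unfoldʳ (shift f) g m))
        (sym (ℤP.+-assoc (f 0 *ᶻ g (suc (suc m))) _ _))

⋆-comm : ∀ f g m → (f ⋆ g) m ≡ (g ⋆ f) m
⋆-comm f g zero    = ℤP.*-comm (f 0) (g 0)
⋆-comm f g (suc m) =
  trans (cong (f 0 *ᶻ g (suc m) +ᶻ_) (⋆-comm (shift f) g m))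
        (trans (swap (f 0) (g (suc m)) _) (sym (⋆-unfoldʳ g f m)))
  where
  swap : ∀ a b x → a *ᶻ b +ᶻ x ≡ x +ᶻ b *ᶻ a
  swap = solve-∀

⋆-assoc : ∀ f g h m → ((f ⋆ g) ⋆ h) m ≡ (f ⋆ (g ⋆ h)) m
⋆-assoc f g h zero    = ℤP.*-assoc (f 0) (g 0) (h 0)
⋆-assoc f g h (suc m) = begin
  c +ᶻ ((λ i → f 0 *ᶻ shift g i +ᶻ (shift f ⋆ g) i) ⋆ h) m
    ≡⟨ cong (c +ᶻ_) (⋆-distribʳ-+ (λ i → f 0 *ᶻ shift g i) (shift f ⋆ g) h m) ⟩
  c +ᶻ (((λ i → f 0 *ᶻ shift g i) ⋆ h) m +ᶻ ((shift f ⋆ g) ⋆ h) m)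
    ≡⟨ cong₂ (λ x y → c +ᶻ (x +ᶻ y)) (⋆-scaleˡ (f 0) (shift g) h m) (⋆-assoc (shift f) g h m) ⟩
  c +ᶻ (f 0 *ᶻ (shift g ⋆ h) m +ᶻ (shift f ⋆ (g ⋆ h)) m)
    ≡⟨ regroup (f 0) (g 0) (h (suc m)) _ _ ⟩
  f 0 *ᶻ (g 0 *ᶻ h (suc m) +ᶻ (shift g ⋆ h) m) +ᶻ (shift f ⋆ (g ⋆ h)) m
    ∎
  where
  open ≡-Reasoning
  c : ℤ
  c = (f 0 *ᶻ g 0) *ᶻ h (suc m)
  regroup : ∀ a b c x y → (a *ᶻ b) *ᶻ c +ᶻ (a *ᶻ x +ᶻ y) ≡ a *ᶻ (b *ᶻ c +ᶻ x) +ᶻ y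
  regroup = solve-∀

⋆-identityʳ : ∀ f m → (f ⋆ δ) m ≡ f m
⋆-identityʳ f zero    = ℤP.*-identityʳ (f 0)
⋆-identityʳ f (suc m) =
  trans (cong₂ _+ᶻ_ (ℤP.*-zeroʳ (f 0)) (⋆-identityʳ (shift f) m)) (ℤP.+-identityˡ (f (suc m)))

⋆-leading : ∀ {f g} d e → (∀ i → d < i → f i ≡ + 0) → (∀ i → e < i → g i ≡ + 0) →
            (f ⋆ g) (d + e) ≡ f d *ᶻ g e
⋆-leading zero    zero    _   _   = refl
⋆-leading {f} {g} zero (suc e) f>0 _ =
  trans (cong (f 0 *ᶻ g (suc e) +ᶻ_) (⋆-zeroˡ g (λ i → f>0 (suc i) (s≤s z≤n)) e))
        (ℤP.+-identityʳ _)
⋆-leading {f} {g} (suc d) e f>d g>e =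
  trans (cong₂ _+ᶻ_ (trans (cong (f 0 *ᶻ_) (g>e (suc (d + e)) (s≤s (ℕP.m≤n+m e d))))
                           (ℤP.*-zeroʳ (f 0)))
                    (⋆-leading d e (λ i d<i → f>d (suc i) (s≤s d<i)) g>e))
        (ℤP.+-identityˡ _)

-- Course-of-values recursion: `covApprox step m` agrees with `cov step` on [0, m].
covApprox : (ℕ → Series → ℤ) → ℕ → Series
covApprox step zero    _ = step 0 (λ _ → + 0)
covApprox step (suc m) i with i ≤? m
... | yes _ = covApprox step m i
... | no  _ = step (suc m) (covApprox step m)

cov : (ℕ → Series → ℤ) → Series
cov step m = covApprox step m m

module _ (step : ℕ → Series → ℤ)
         (step-local : ∀ m {h h′} → (∀ i → i < m → h i ≡ h′ i) → step m h ≡ step m h′)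
  where

  private
    covApprox-new : ∀ m → covApprox step (suc m) (suc m) ≡ step (suc m) (covApprox step m)
    covApprox-new m with suc m ≤? m
    ... | yes 1+m≤m = ⊥-elim (ℕP.1+n≰n 1+m≤m)
    ... | no  _     = refl

    covApprox-stable : ∀ m i → i ≤ m → covApprox step m i ≡ cov step i
    covApprox-stable zero    zero z≤n = refl
    covApprox-stable (suc m) i i≤1+m with i ≤? m
    ... | yes i≤m = covApprox-stable m i i≤m
    ... | no  i≰m rewrite ℕP.≤-antisym i≤1+m (ℕP.≰⇒> i≰m) = sym (covApprox-new m)

  cov-unfold : ∀ m → cov step m ≡ step m (cov step)
  cov-unfold zero    = step-local 0 (λ _ ())
  cov-unfold (suc m) =
    trans (covApprox-new m)
          (step-local (suc m) (λ i i<1+m → covApprox-stable m i (ℕP.≤-pred i<1+m)))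

inverseStep : Series → ℤ → ℕ → Series → ℤ
inverseStep α u zero    _ = u
inverseStep α u (suc m) h = - (u *ᶻ (shift α ⋆ h) m)

inverse : Series → ℤ → Series
inverse α u = cov (inverseStep α u)

inverse-unfold : ∀ α u m → inverse α u m ≡ inverseStep α u m (inverse α u)
inverse-unfold α u = cov-unfold (inverseStep α u) local
  where
  local : ∀ m {h h′} → (∀ i → i < m → h i ≡ h′ i) →
          inverseStep α u m h ≡ inverseStep α u m h′
  local zero    _    = refl
  local (suc m) h≡h′ =
    cong (λ x → - (u *ᶻ x)) (⋆-congʳ (shift α) m (λ i i≤m → h≡h′ i (s≤s i≤m)))

⋆-inverseʳ : ∀ α u → α 0 *ᶻ u ≡ + 1 → ∀ m → (α ⋆ inverse α u) m ≡ δ m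
⋆-inverseʳ α u α₀u≡1 zero = trans (cong (α 0 *ᶻ_) (inverse-unfold α u 0)) α₀u≡1
⋆-inverseʳ α u α₀u≡1 (suc m) = begin
  α 0 *ᶻ inverse α u (suc m) +ᶻ x  ≡⟨ cong (λ y → α 0 *ᶻ y +ᶻ x) (inverse-unfold α u (suc m)) ⟩
  α 0 *ᶻ - (u *ᶻ x) +ᶻ x           ≡⟨ cancel (α 0) u x ⟩
  (+ 1 -ᶻ α 0 *ᶻ u) *ᶻ x           ≡⟨ cong (λ y → (+ 1 -ᶻ y) *ᶻ x) α₀u≡1 ⟩
  + 0 *ᶻ x                         ≡⟨ ℤP.*-zeroˡ x ⟩
  + 0                              ∎
  where
  open ≡-Reasoning
  x : ℤ
  x = (shift α ⋆ inverse α u) m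
  cancel : ∀ a b x → a *ᶻ - (b *ᶻ x) +ᶻ x ≡ (+ 1 -ᶻ a *ᶻ b) *ᶻ x
  cancel = solve-∀

IsZero : Series → Set
IsZero f = ∀ i → f i ≡ + 0

EventuallyZero : Series → Set
EventuallyZero f = ∃ λ B → ∀ i → B ≤ i → f i ≡ + 0

HasDegree : Series → ℕ → Set
HasDegree f d = ¬ f d ≡ + 0 × (∀ i → d < i → f i ≡ + 0)

isZero⊎hasDegree : ∀ {f} → EventuallyZero f → IsZero f ⊎ ∃ (HasDegree f)
isZero⊎hasDegree (B , f≥B≡0) = below B f≥B≡0
  where
  below : ∀ {f} B → (∀ i → B ≤ i → f i ≡ + 0) → IsZero f ⊎ ∃ (HasDegree f)
  below zero    f≥0≡0 = inj₁ (λ i → f≥0≡0 i z≤n)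
  below {f} (suc B) f>B≡0 with f B ≟ + 0
  ... | no  fB≢0 = inj₂ (B , fB≢0 , f>B≡0)
  ... | yes fB≡0 = below B (λ i B≤i →
                     [ f>B≡0 i , (λ { refl → fB≡0 }) ]′ (ℕP.m≤n⇒m<n∨m≡n B≤i))

⋆-invertible⇒constant : ∀ {f g} → (∀ m → (f ⋆ g) m ≡ δ m) →
                        EventuallyZero f → EventuallyZero g → ∀ k → f (suc k) ≡ + 0
⋆-invertible⇒constant {f} {g} fg≡δ f↓ g↓ k with isZero⊎hasDegree f↓
... | inj₁ f≡0                       = f≡0 (suc k)
... | inj₂ (zero , _ , f>0≡0)        = f>0≡0 (suc k) (s≤s z≤n)
... | inj₂ (suc d , fd≢0 , f>d≡0)    = ⊥-elim (absurd (isZero⊎hasDegree g↓))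
  where
  absurd : IsZero g ⊎ ∃ (HasDegree g) → ⊥
  absurd (inj₁ g≡0) with () ← trans (sym (fg≡δ 0)) (trans (cong (f 0 *ᶻ_) (g≡0 0)) (ℤP.*-zeroʳ (f 0)))
  absurd (inj₂ (e , ge≢0 , g>e≡0)) =
    [ fd≢0 , ge≢0 ]′ (ℤP.i*j≡0⇒i≡0∨j≡0 (f (suc d))
      (trans (sym (⋆-leading (suc d) e f>d≡0 g>e≡0)) (fg≡δ (suc d + e))))

ℕ-bounded : ∀ (f : ℕ → ℕ) n → ∃ λ w → ∀ k → k ≤ n → f k ≤ w
ℕ-bounded f zero    = f 0 , λ { zero z≤n → ℕP.≤-refl }
ℕ-bounded f (suc n) with ℕ-bounded f n
... | w , f≤w = w ⊔ f (suc n) , λ k k≤1+n → bound k (ℕP.m≤n⇒m<n∨m≡n k≤1+n)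
  where
  bound : ∀ k → k < suc n ⊎ k ≡ suc n → f k ≤ w ⊔ f (suc n)
  bound k (inj₁ k<1+n) = ℕP.≤-trans (f≤w k (ℕP.≤-pred k<1+n)) (ℕP.m≤m⊔n w _)
  bound k (inj₂ refl)  = ℕP.m≤n⊔m w _

WindowBound : Series → ℕ → ℕ → ℕ → Set
WindowBound h n w j = ∀ k → k ≤ n → ∣ h (k + j) ∣ ≤ w

module _ (h : Series) {μ T : ℕ} (n L : ℕ) (T<μ : T < μ)
         (contract : ∀ j w → L ≤ j → WindowBound h n w j → μ * ∣ h (suc n + j) ∣ ≤ T * w)
  where

  private
    contract-strict : ∀ j w → L ≤ j → WindowBound h n (suc w) j → ∣ h (suc n + j) ∣ ≤ w
    contract-strict j w L≤j hw = ℕP.≤-pred (ℕP.*-cancelˡ-< μ _ (suc w)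
      (ℕP.≤-<-trans (contract j (suc w) L≤j hw) (ℕP.*-monoˡ-< (suc w) T<μ)))

    contract-weak : ∀ j w → L ≤ j → WindowBound h n w j → ∣ h (suc n + j) ∣ ≤ w
    contract-weak j w L≤j hw = contract-strict j w L≤j (λ k k≤n → ℕP.m≤n⇒m≤1+n (hw k k≤n))

    slide : ∀ w j → L ≤ j → WindowBound h n w j → WindowBound h n w (suc j)
    slide w j L≤j hw k k≤n with ℕP.m≤n⇒m<n∨m≡n k≤n
    ... | inj₁ k<n  = subst (λ i → ∣ h i ∣ ≤ w) (sym (ℕP.+-suc k j)) (hw (suc k) k<n)
    ... | inj₂ refl = subst (λ i → ∣ h i ∣ ≤ w) (sym (ℕP.+-suc n j)) (contract-weak j w L≤j hw)

    slide* : ∀ t w j → L ≤ j → WindowBound h n w j → WindowBound h n w (t + j)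
    slide* zero    w j L≤j hw = hw
    slide* (suc t) w j L≤j hw =
      slide w (t + j) (ℕP.≤-trans L≤j (ℕP.m≤n+m j t)) (slide* t w j L≤j hw)

    shrink : ∀ w j → L ≤ j → WindowBound h n (suc w) j → WindowBound h n w (suc n + j)
    shrink w j L≤j hw k k≤n =
      subst (λ i → ∣ h i ∣ ≤ w) (left-comm (suc n) k j)
        (contract-strict (k + j) w (ℕP.≤-trans L≤j (ℕP.m≤n+m j k)) (slide* k (suc w) j L≤j hw))
      where
      left-comm : ∀ a b c → a + (b + c) ≡ b + (a + c)
      left-comm a b c = trans (sym (ℕP.+-assoc a b c))
                              (trans (cong (_+ c) (ℕP.+-comm a b)) (ℕP.+-assoc b a c))

    descend : ∀ w j → L ≤ j → WindowBound h n w j → ∃ λ J → L ≤ J × WindowBound h n 0 J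
    descend zero    j L≤j hw = j , L≤j , hw
    descend (suc w) j L≤j hw =
      descend w (suc n + j) (ℕP.≤-trans L≤j (ℕP.m≤n+m j (suc n))) (shrink w j L≤j hw)

  contracting⇒eventuallyZero : EventuallyZero h
  contracting⇒eventuallyZero with ℕ-bounded (λ k → ∣ h (k + L) ∣) n
  ... | w , hw with descend w L ℕP.≤-refl hw
  ... | J , L≤J , h≡0 = J , λ i J≤i → ℤP.∣i∣≡0⇒i≡0 (ℕP.n≤0⇒n≡0
          (subst (λ t → ∣ h t ∣ ≤ 0) (ℕP.m∸n+n≡m J≤i) (slide* (i ∸ J) 0 J L≤J h≡0 0 z≤n)))

coeff-+ₚ : ∀ p q k → coeff (p +ₚ q) k ≡ coeff p k +ᶻ coeff q k
coeff-+ₚ []      q       k       = sym (ℤP.+-identityˡ _)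
coeff-+ₚ (a ∷ p) []      k       = sym (ℤP.+-identityʳ _)
coeff-+ₚ (a ∷ p) (b ∷ q) zero    = refl
coeff-+ₚ (a ∷ p) (b ∷ q) (suc k) = coeff-+ₚ p q k

coeff-scale : ∀ c q k → coeff (map (c *ᶻ_) q) k ≡ c *ᶻ coeff q k
coeff-scale c []      k       = sym (ℤP.*-zeroʳ c)
coeff-scale c (b ∷ q) zero    = refl
coeff-scale c (b ∷ q) (suc k) = coeff-scale c q k

coeff-*ₚ : ∀ p q k → coeff (p *ₚ q) k ≡ (coeff p ⋆ coeff q) k
coeff-*ₚ []      q k       = sym (⋆-zeroˡ (coeff q) (λ _ → refl) k)
coeff-*ₚ (a ∷ p) q zero    =
  trans (coeff-+ₚ (map (a *ᶻ_) q) (+ 0 ∷ p *ₚ q) 0)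
        (trans (ℤP.+-identityʳ _) (coeff-scale a q 0))
coeff-*ₚ (a ∷ p) q (suc k) =
  trans (coeff-+ₚ (map (a *ᶻ_) q) (+ 0 ∷ p *ₚ q) (suc k))
        (cong₂ _+ᶻ_ (coeff-scale a q (suc k)) (coeff-*ₚ p q k))

*ₚ-comm : ∀ p q → p *ₚ q ≈ₚ q *ₚ p
*ₚ-comm p q k = trans (coeff-*ₚ p q k) (trans (⋆-comm (coeff p) (coeff q) k) (sym (coeff-*ₚ q p k)))

coeff-≥length : ∀ p k → length p ≤ k → coeff p k ≡ + 0
coeff-≥length []      k       _               = refl
coeff-≥length (a ∷ p) (suc k) (s≤s length≤k) = coeff-≥length p k length≤k

coeff-eventuallyZero : ∀ p → EventuallyZero (coeff p)
coeff-eventuallyZero p = length p , coeff-≥length p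

sumAbs : List ℤ → ℕ
sumAbs xs = sum (map ∣_∣ xs)

sumAbs-++ : ∀ xs ys → sumAbs (xs ++ ys) ≡ sumAbs xs + sumAbs ys
sumAbs-++ xs ys = trans (cong sum (map-++ ∣_∣ xs ys)) (sum-++ (map ∣_∣ xs) (map ∣_∣ ys))

sumAbs-zeros : ∀ k → sumAbs (replicate k (+ 0)) ≡ 0
sumAbs-zeros zero    = refl
sumAbs-zeros (suc k) = sumAbs-zeros k

∣coeff-⋆∣≤sumAbs* : ∀ ℓ g m W → (∀ i → i < length ℓ → ∣ g (m ∸ i) ∣ ≤ W) →
                     ∣ (coeff ℓ ⋆ g) m ∣ ≤ sumAbs ℓ * W
∣coeff-⋆∣≤sumAbs* []      g m       W _ = ℕP.≤-reflexive (cong ∣_∣ (⋆-zeroˡ g (λ _ → refl) m))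
∣coeff-⋆∣≤sumAbs* (x ∷ ℓ) g zero    W g≤W = begin
  ∣ x *ᶻ g 0 ∣             ≡⟨ ℤP.abs-* x (g 0) ⟩
  ∣ x ∣ * ∣ g 0 ∣          ≤⟨ ℕP.*-monoʳ-≤ ∣ x ∣ (g≤W 0 (s≤s z≤n)) ⟩
  ∣ x ∣ * W                ≤⟨ ℕP.*-monoˡ-≤ W (ℕP.m≤m+n ∣ x ∣ (sumAbs ℓ)) ⟩
  (∣ x ∣ + sumAbs ℓ) * W   ∎
  where open ℕP.≤-Reasoning
∣coeff-⋆∣≤sumAbs* (x ∷ ℓ) g (suc m) W g≤W = begin
  ∣ x *ᶻ g (suc m) +ᶻ (coeff ℓ ⋆ g) m ∣      ≤⟨ ℤP.∣i+j∣≤∣i∣+∣j∣ (x *ᶻ g (suc m)) _ ⟩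
  ∣ x *ᶻ g (suc m) ∣ + ∣ (coeff ℓ ⋆ g) m ∣    ≡⟨ cong (_+ _) (ℤP.abs-* x (g (suc m))) ⟩
  ∣ x ∣ * ∣ g (suc m) ∣ + ∣ (coeff ℓ ⋆ g) m ∣
    ≤⟨ ℕP.+-mono-≤ (ℕP.*-monoʳ-≤ ∣ x ∣ (g≤W 0 (s≤s z≤n)))
                   (∣coeff-⋆∣≤sumAbs* ℓ g m W (λ i i<ℓ → g≤W (suc i) (s≤s i<ℓ))) ⟩
  ∣ x ∣ * W + sumAbs ℓ * W                   ≡⟨ ℕP.*-distribʳ-+ W ∣ x ∣ (sumAbs ℓ) ⟨
  (∣ x ∣ + sumAbs ℓ) * W                      ∎
  where open ℕP.≤-Reasoning

i+j≡0⇒∣i∣≡∣j∣ : ∀ i j → i +ᶻ j ≡ + 0 → ∣ i ∣ ≡ ∣ j ∣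
i+j≡0⇒∣i∣≡∣j∣ i j i+j≡0 = begin
  ∣ i ∣               ≡⟨ cong ∣_∣ (cancel i j) ⟩
  ∣ (i +ᶻ j) -ᶻ j ∣   ≡⟨ cong (λ x → ∣ x -ᶻ j ∣) i+j≡0 ⟩
  ∣ + 0 -ᶻ j ∣        ≡⟨ cong ∣_∣ (ℤP.+-identityˡ (- j)) ⟩
  ∣ - j ∣             ≡⟨ ℤP.∣-i∣≡∣i∣ j ⟩
  ∣ j ∣               ∎
  where
  open ≡-Reasoning
  cancel : ∀ i j → i ≡ (i +ᶻ j) -ᶻ j
  cancel = solve-∀

IsSign⇒i*i≡1 : ∀ {x} → IsSign x → x *ᶻ x ≡ + 1
IsSign⇒i*i≡1 (inj₁ refl) = refl
IsSign⇒i*i≡1 (inj₂ refl) = refl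

IsSign⇒∣i∣≡1 : ∀ {x} → IsSign x → ∣ x ∣ ≡ 1
IsSign⇒∣i∣≡1 (inj₁ refl) = refl
IsSign⇒∣i∣≡1 (inj₂ refl) = refl

∣i∣≡1⇒IsSign : ∀ x → ∣ x ∣ ≡ 1 → IsSign x
∣i∣≡1⇒IsSign (+ 1)     refl = inj₁ refl
∣i∣≡1⇒IsSign -[1+ 0 ]  refl = inj₂ refl

IsUnit⇒∣coeff₀∣≡1 : ∀ {p} → IsUnit p → ∣ coeff p 0 ∣ ≡ 1
IsUnit⇒∣coeff₀∣≡1 (inj₁ p≈1)  = cong ∣_∣ (p≈1 0)
IsUnit⇒∣coeff₀∣≡1 (inj₂ p≈-1) = cong ∣_∣ (p≈-1 0)

constant⇒IsUnit : ∀ p → IsSign (coeff p 0) → (∀ k → coeff p (suc k) ≡ + 0) → IsUnit p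
constant⇒IsUnit p (inj₁ p₀≡1)  p>0≡0 = inj₁ λ { zero → p₀≡1  ; (suc k) → p>0≡0 k }
constant⇒IsUnit p (inj₂ p₀≡-1) p>0≡0 = inj₂ λ { zero → p₀≡-1 ; (suc k) → p>0≡0 k }

prime≡*⇒≡1⊎≡1 : ∀ {p m n} → Prime p → p ≡ m * n → m ≡ 1 ⊎ n ≡ 1
prime≡*⇒≡1⊎≡1 {p} {m} {n} p-prime p≡mn
  with prime⇒irreducible p-prime (divides n (trans p≡mn (ℕP.*-comm m n)))
... | inj₁ m≡1 = inj₁ m≡1
... | inj₂ refl = inj₂ (sym (ℕP.*-cancelˡ-≡ 1 n p {{prime⇒nonZero p-prime}}
                              (trans (ℕP.*-identityʳ p) p≡mn)))

dominantConstant⇒factorIsUnit : ∀ c ℓ a b → sumAbs ℓ < ∣ c ∣ → c ∷ ℓ ≈ₚ a *ₚ b →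
                                IsSign (coeff a 0) → IsUnit a
dominantConstant⇒factorIsUnit c ℓ a b Σ|ℓ|<∣c∣ P≈ab a₀± =
  constant⇒IsUnit a a₀±
    (⋆-invertible⇒constant α⋆h≡δ (coeff-eventuallyZero a)
      (contracting⇒eventuallyZero h (length ℓ) (length b) Σ|ℓ|<∣c∣ contract))
  where
  α : Series
  α = coeff a
  h : Series
  h = inverse α (α 0)
  α⋆h≡δ : ∀ m → (α ⋆ h) m ≡ δ m
  α⋆h≡δ = ⋆-inverseʳ α (α 0) (IsSign⇒i*i≡1 a₀±)

  P⋆h≡b : ∀ m → (coeff (c ∷ ℓ) ⋆ h) m ≡ coeff b m
  P⋆h≡b m = begin
    (coeff (c ∷ ℓ) ⋆ h) m  ≡⟨ ⋆-congˡ h P≈ba m ⟩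
    ((coeff b ⋆ α) ⋆ h) m  ≡⟨ ⋆-assoc (coeff b) α h m ⟩
    (coeff b ⋆ (α ⋆ h)) m  ≡⟨ ⋆-congʳ (coeff b) m (λ i _ → α⋆h≡δ i) ⟩
    (coeff b ⋆ δ) m        ≡⟨ ⋆-identityʳ (coeff b) m ⟩
    coeff b m              ∎
    where
    open ≡-Reasoning
    P≈ba : ∀ k → coeff (c ∷ ℓ) k ≡ (coeff b ⋆ α) k
    P≈ba k = trans (P≈ab k) (trans (*ₚ-comm a b k) (coeff-*ₚ b a k))

  contract : ∀ j w → length b ≤ j → WindowBound h (length ℓ) w j →
             ∣ c ∣ * ∣ h (suc (length ℓ) + j) ∣ ≤ sumAbs ℓ * w
  contract j w length-b≤j h≤w = begin
    ∣ c ∣ * ∣ h (suc m) ∣    ≡⟨ ℤP.abs-* c (h (suc m)) ⟨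
    ∣ c *ᶻ h (suc m) ∣       ≡⟨ i+j≡0⇒∣i∣≡∣j∣ (c *ᶻ h (suc m)) ((coeff ℓ ⋆ h) m) (trans (P⋆h≡b (suc m)) (coeff-≥length b (suc m) length-b≤1+m)) ⟩
    ∣ (coeff ℓ ⋆ h) m ∣      ≤⟨ ∣coeff-⋆∣≤sumAbs* ℓ h m w window ⟩
    sumAbs ℓ * w             ∎
    where
    open ℕP.≤-Reasoning
    m : ℕ
    m = length ℓ + j
    length-b≤1+m : length b ≤ suc m
    length-b≤1+m = ℕP.≤-trans length-b≤j (ℕP.m≤n+m j (suc (length ℓ)))
    window : ∀ i → i < length ℓ → ∣ h (m ∸ i) ∣ ≤ w
    window i i<ℓ = subst (λ t → ∣ h t ∣ ≤ w) (sym (ℕP.+-∸-comm j (ℕP.<⇒≤ i<ℓ)))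
                         (h≤w (length ℓ ∸ i) (ℕP.m∸n≤m (length ℓ) i))

primeDominantConstant⇒irreducible : ∀ c ℓ → Prime ∣ c ∣ → sumAbs ℓ < ∣ c ∣ → Irreducible (c ∷ ℓ)
primeDominantConstant⇒irreducible c ℓ ∣c∣-prime Σ|ℓ|<∣c∣ = nonZero , nonUnit , factor
  where
  nonZero : ¬ (c ∷ ℓ ≈ₚ [])
  nonZero P≈0 = ¬prime[0] (subst Prime (cong ∣_∣ (P≈0 0)) ∣c∣-prime)

  nonUnit : ¬ IsUnit (c ∷ ℓ)
  nonUnit P-unit = ¬prime[1] (subst Prime (IsUnit⇒∣coeff₀∣≡1 {c ∷ ℓ} P-unit) ∣c∣-prime)

  factor : ∀ a b → c ∷ ℓ ≈ₚ a *ₚ b → IsUnit a ⊎ IsUnit b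
  factor a b P≈ab
    with prime≡*⇒≡1⊎≡1 ∣c∣-prime
           (trans (cong ∣_∣ (trans (P≈ab 0) (coeff-*ₚ a b 0))) (ℤP.abs-* (coeff a 0) (coeff b 0)))
  ... | inj₁ ∣a₀∣≡1 = inj₁ (dominantConstant⇒factorIsUnit c ℓ a b Σ|ℓ|<∣c∣ P≈ab
                              (∣i∣≡1⇒IsSign (coeff a 0) ∣a₀∣≡1))
  ... | inj₂ ∣b₀∣≡1 = inj₂ (dominantConstant⇒factorIsUnit c ℓ b a Σ|ℓ|<∣c∣
                              (λ k → trans (P≈ab k) (*ₚ-comm a b k))
                              (∣i∣≡1⇒IsSign (coeff b 0) ∣b₀∣≡1))

proposition9 : (n : ℕ) → 2 ≤ n → (μ : ℕ) → Prime μ →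
    (ε : Fin (n / 2) → ℤ) → (∀ i → IsTrit (ε i)) →
    (s : ℤ) → IsSign s →
    1 + absSum n ε < μ →
    Irreducible (thePoly n ε s μ)
proposition9 n _ μ μ-prime ε _ s s± 1+Σ|ε|<μ =
  primeDominantConstant⇒irreducible (s *ᶻ + μ) tail
    (subst Prime (sym ∣sμ∣≡μ) μ-prime)
    (subst₂ _<_ (sym sumAbs-tail) (sym ∣sμ∣≡μ) 1+Σ|ε|<μ)
  where
  zeros : ℕ
  zeros = n ∸ 1 ∸ (n / 2)
  tail : List ℤ
  tail = tabulate ε ++ (replicate zeros (+ 0) ++ [ + 1 ])

  ∣sμ∣≡μ : ∣ s *ᶻ + μ ∣ ≡ μ
  ∣sμ∣≡μ = trans (ℤP.abs-* s (+ μ)) (trans (cong (_* μ) (IsSign⇒∣i∣≡1 s±)) (ℕP.*-identityˡ μ))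

  sumAbs-tail : sumAbs tail ≡ 1 + absSum n ε
  sumAbs-tail = begin
    sumAbs tail                                                       ≡⟨ sumAbs-++ (tabulate ε) _ ⟩
    sumAbs (tabulate ε) + sumAbs (replicate zeros (+ 0) ++ [ + 1 ])
      ≡⟨ cong₂ _+_ (cong sum (map-tabulate ε ∣_∣))
                   (trans (sumAbs-++ (replicate zeros (+ 0)) [ + 1 ]) (cong (_+ 1) (sumAbs-zeros zeros))) ⟩
    absSum n ε + 1                                                    ≡⟨ ℕP.+-comm (absSum n ε) 1 ⟩
    1 + absSum n ε                                                    ∎
    where open ≡-Reasoning
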